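{- Let $q\ge 2$, let $X$ be a finite set, and let $\mathcal C\subseteq \mathbb Z_q^X$ be a code in which every codeword has Hamming weight $w$. Then $\mathcal C$ has distance $2w-2$ (i.e. $d(\mathsf u,\mathsf v)\ge 2w-2$ for all distinct $\mathsf u,\mathsf v\in\mathcal C$) if and only if both of the following hold: (C1) for each $i\in\{1,\dots,q-1\}$, the ordered pairs $(x,y)$ arising as $x,y\in X$ with $\mathsf u_x=i$, $y\in \mathrm{supp}(\mathsf u)\setminus\{x\}$, $\mathsf u\in\mathcal C$, are all distinct (that is, no ordered pair $(x,y)$ arises in this way from two different codewords); (C2) for any distinct $\mathsf u,\mathsf v\in\mathcal C$, $|\mathrm{supp}(\mathsf u)\cap\mathrm{supp}(\mathsf v)|\le 2$.
   Context: $\mathbb Z_q=\mathbb Z/q\mathbb Z$, and $\mathbb Z_q^X$ denotes vectors with entries in $\mathbb Z_q$ indexed by $X$. The support of $\mathsf u$ is $\mathrm{supp}(\mathsf u)=\{x\in X:\mathsf u_x\neq 0\}$, its Hamming weight is $|\mathrm{supp}(\mathsf u)|$, and the Hamming distance is $d(\mathsf u,\mathsf v)=|\mathrm{supp}(\mathsf u-\mathsf v)|$. A code has distance $d$ if any two distinct codewords are at Hamming distance at least $d$. -}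

module Defs where

open import Data.Nat using (ℕ; zero; suc; _≤_; _≥_)
open import Data.Fin using (Fin; toℕ)
open import Data.Fin.Subset using (Subset; _∈_; _∩_; ∣_∣)
open import Data.Vec using (Vec; lookup; tabulate)
open import Data.Bool using (Bool; true; false; not)
open import Data.Product using (_×_)
open import Relation.Nullary using (¬_)
open import Relation.Nullary.Decidable using (⌊_⌋)
open import Relation.Binary.PropositionalEquality using (_≡_; _≢_)
import Data.Nat as ℕ
import Data.Fin as F

-- Z_q is represented by Fin q (residues 0..q-1); X is Fin n.
-- A word in Z_q^X is a vector of length n over Fin q.
Word : ℕ → ℕ → Set
Word q n = Vec (Fin q) n

NonZeroᶻ : {q : ℕ} → Fin q → Set
NonZeroᶻ a = toℕ a ≢ 0

supp : {q n : ℕ} → Word q n → Subset n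
supp u = tabulate (λ x → not ⌊ toℕ (lookup u x) ℕ.≟ 0 ⌋)

weight : {q n : ℕ} → Word q n → ℕ
weight u = ∣ supp u ∣

-- supp(u - v) = { x : u_x ≠ v_x }  (u_x - v_x ≠ 0 in Z_q iff u_x ≠ v_x)
diffSupp : {q n : ℕ} → Word q n → Word q n → Subset n
diffSupp u v = tabulate (λ x → not ⌊ lookup u x F.≟ lookup v x ⌋)

dist : {q n : ℕ} → Word q n → Word q n → ℕ
dist u v = ∣ diffSupp u v ∣

Code : ℕ → ℕ → Set₁
Code q n = Word q n → Set

HasDistance : {q n : ℕ} → Code q n → ℕ → Set
HasDistance C d = ∀ u v → C u → C v → u ≢ v → dist u v ≥ d

Arises : {q n : ℕ} → Fin q → Word q n → Fin n → Fin n → Set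
Arises i u x y = (lookup u x ≡ i) × (y ∈ supp u) × (y ≢ x)

C1 : {q n : ℕ} → Code q n → Set
C1 {q} {n} C = (i : Fin q) → NonZeroᶻ i →
  ∀ u v → C u → C v → (x y : Fin n) → Arises i u x y → Arises i v x y → u ≡ v

C2 : {q n : ℕ} → Code q n → Set
C2 C = ∀ u v → C u → C v → u ≢ v → ∣ supp u ∩ supp v ∣ ≤ 2

module Submission where

open import Defs
open import Data.Nat using (ℕ; _≤_; _*_; _∸_)
open import Data.Product using (_×_)
open import Function.Bundles using (_⇔_)
open import Relation.Binary.PropositionalEquality using (_≡_)

open import Data.Nat using (zero; suc; _+_; z≤n; s≤s)
open import Data.Nat.Properties
  using (≤-refl; ≤-trans; ≤-reflexive; m≤m+n; m≤n+m∸n; m≤n+o⇒m∸n≤o;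
         +-comm; +-assoc; +-identityʳ; +-cancelˡ-≤; +-monoʳ-≤; +-mono-≤)
open import Data.Nat.Tactic.RingSolver using (solve-∀)
open import Data.Bool using (Bool; true; false; not; _∧_; T)
open import Data.Bool.Properties using (T-∧; T-≡)
open import Data.Fin using (Fin; toℕ)
open import Data.Fin.Properties using (any?; toℕ-injective)
open import Data.Fin.Subset using (Subset; _∈_; _∩_; ∣_∣; _-_; _⊆_; ⁅_⁆; Nonempty)
open import Data.Fin.Subset.Properties
  using (x∈p∩q⁺; x∈p∩q⁻; x∈p∧x≢y⇒x∈p-y; x∈p⇒∣p-x∣<∣p∣; nonempty?; Empty-unique; ∣⊥∣≡0;
         p⊆q⇒∣p∣≤∣q∣; x∈⁅x⁆; ∣⁅x⁆∣≡1; _∈?_)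
open import Data.Vec using ([]; _∷_; lookup; tabulate)
open import Data.Vec.Properties using (≡-dec; lookup∘tabulate; []=⇒lookup; lookup⇒[]=)
open import Data.Product using (∃; ∃₂; _,_; proj₁; proj₂)
open import Data.Empty using (⊥-elim)
open import Relation.Nullary using (¬_; Dec; yes; no; contradiction; ¬?)
open import Relation.Nullary.Decidable
  using (⌊_⌋; decidable-stable; toWitness; fromWitness; toWitnessFalse; fromWitnessFalse; _×-dec_)
open import Relation.Binary.PropositionalEquality
  using (refl; sym; trans; cong; cong₂; subst; _≢_; module ≡-Reasoning)
open import Function.Bundles using (mk⇔; Equivalence)
open import Function.Properties.Equivalence using (⇔-setoid) renaming (refl to ⇔-refl; sym to ⇔-sym)
open import Data.Product.Function.NonDependent.Propositional using (_×-⇔_)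
open import Function.Related.TypeIsomorphisms using (¬-cong-⇔)
import Relation.Binary.Reasoning.Setoid as SetoidReasoning
import Data.Nat as ℕ
import Data.Fin as F

-- For words u, v call  A(u,v) = { x : u_x = v_x ≠ 0 }  their agreement set.  Checking
-- each coordinate separately gives the counting identity
--     d(u,v) + |supp u ∩ supp v| + |A(u,v)| = wt(u) + wt(v),
-- and clearly A(u,v) ⊆ supp u ∩ supp v.  Hence, for two codewords of weight w,
--     d(u,v) ≥ 2w − 2   iff   |supp u ∩ supp v| + |A(u,v)| ≤ 2.
-- Two distinct codewords violate (C1) exactly when some x ∈ A(u,v) has a second common
-- support position y, i.e. exactly when |A(u,v)| ≥ 1 and |supp u ∩ supp v| ≥ 2.  Since
-- |A(u,v)| ≤ |supp u ∩ supp v|, an elementary fact about natural numbers a ≤ c shows that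
--     c + a ≤ 2   iff   ¬ (a ≥ 1 ∧ c ≥ 2)  and  c ≤ 2,
-- which is (C1) ∧ (C2) for the pair u, v.

∈-tabulate : {n : ℕ} (f : Fin n → Bool) {x : Fin n} → x ∈ tabulate f ⇔ T (f x)
∈-tabulate f {x} = mk⇔
  (λ x∈ → Equivalence.from T-≡ (trans (sym (lookup∘tabulate f x)) ([]=⇒lookup x∈)))
  (λ t → lookup⇒[]= x (tabulate f) (trans (lookup∘tabulate f x) (Equivalence.to T-≡ t)))

∈⇒1≤∣p∣ : {n : ℕ} {p : Subset n} {x : Fin n} → x ∈ p → 1 ≤ ∣ p ∣
∈⇒1≤∣p∣ x∈p = ≤-trans (s≤s z≤n) (x∈p⇒∣p-x∣<∣p∣ x∈p)

distinct⇒2≤∣p∣ : {n : ℕ} {p : Subset n} {x y : Fin n} → x ∈ p → y ∈ p → y ≢ x → 2 ≤ ∣ p ∣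
distinct⇒2≤∣p∣ x∈p y∈p y≢x =
  ≤-trans (s≤s (∈⇒1≤∣p∣ (x∈p∧x≢y⇒x∈p-y y∈p y≢x))) (x∈p⇒∣p-x∣<∣p∣ x∈p)

1≤∣p∣⇒nonempty : {n : ℕ} {p : Subset n} → 1 ≤ ∣ p ∣ → Nonempty p
1≤∣p∣⇒nonempty {n} {p} 1≤∣p∣ with nonempty? p
... | yes ne = ne
... | no empty = contradiction
  (≤-trans 1≤∣p∣ (≤-reflexive (trans (cong ∣_∣ (Empty-unique empty)) (∣⊥∣≡0 n)))) λ ()

-- A subset with at least two elements contains an element other than any given one:
-- otherwise it would be contained in a singleton.
another-element : {n : ℕ} {p : Subset n} {x : Fin n} → 2 ≤ ∣ p ∣ → ∃ λ y → y ∈ p × y ≢ x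
another-element {p = p} {x} 2≤∣p∣ with any? (λ y → (y ∈? p) ×-dec ¬? (y F.≟ x))
... | yes found = found
... | no none = contradiction
  (≤-trans 2≤∣p∣ (≤-trans (p⊆q⇒∣p∣≤∣q∣ p⊆⁅x⁆) (≤-reflexive (∣⁅x⁆∣≡1 x)))) λ { (s≤s ()) }
  where
  p⊆⁅x⁆ : p ⊆ ⁅ x ⁆
  p⊆⁅x⁆ {y} y∈p with y F.≟ x
  ... | yes refl = x∈⁅x⁆ x
  ... | no y≢x = contradiction (y , y∈p , y≢x) none

lower-bound⇔slack : {d s N : ℕ} (k : ℕ) → d + s ≡ N → (N ∸ k ≤ d) ⇔ (s ≤ k)
lower-bound⇔slack {d} {s} {N} k d+s≡N = mk⇔ to from
  where
  to : N ∸ k ≤ d → s ≤ k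
  to N∸k≤d = +-cancelˡ-≤ d s k (≤-trans (≤-reflexive d+s≡N)
    (≤-trans (m≤n+m∸n N k)
      (≤-trans (+-monoʳ-≤ k N∸k≤d) (≤-reflexive (+-comm k d)))))
  from : s ≤ k → N ∸ k ≤ d
  from s≤k = m≤n+o⇒m∸n≤o N k (≤-trans (≤-reflexive (sym d+s≡N))
    (≤-trans (+-monoʳ-≤ d s≤k) (≤-reflexive (+-comm d k))))

small-sum : {a c : ℕ} → a ≤ c → (c + a ≤ 2) ⇔ (¬ (1 ≤ a × 2 ≤ c) × c ≤ 2)
small-sum {a} {c} a≤c = mk⇔ to (λ (¬both , c≤2) → from a≤c ¬both c≤2)
  where
  to : c + a ≤ 2 → ¬ (1 ≤ a × 2 ≤ c) × c ≤ 2
  to c+a≤2 = (λ { (1≤a , 2≤c) → three≰two (≤-trans (+-mono-≤ 2≤c 1≤a) c+a≤2) })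
           , ≤-trans (m≤m+n c a) c+a≤2
    where
    three≰two : ¬ (3 ≤ 2)
    three≰two (s≤s (s≤s ()))
  from : {a c : ℕ} → a ≤ c → ¬ (1 ≤ a × 2 ≤ c) → c ≤ 2 → c + a ≤ 2
  from {zero}  {c}             _           _     c≤2 = subst (_≤ 2) (sym (+-identityʳ c)) c≤2
  from {suc a} {suc zero}      (s≤s z≤n)   _     _   = ≤-refl
  from {suc a} {suc (suc c)}   _           ¬both _   = ⊥-elim (¬both (s≤s z≤n , s≤s (s≤s z≤n)))

isNonZero : {q : ℕ} → Fin q → Bool
isNonZero a = not ⌊ toℕ a ℕ.≟ 0 ⌋

agrees : {q : ℕ} → Fin q → Fin q → Bool
agrees a b = ⌊ a F.≟ b ⌋ ∧ isNonZero a

agreeSupp : {q n : ℕ} → Word q n → Word q n → Subset n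
agreeSupp u v = tabulate (λ x → agrees (lookup u x) (lookup v x))

∈supp⇔ : {q n : ℕ} (u : Word q n) {x : Fin n} → x ∈ supp u ⇔ NonZeroᶻ (lookup u x)
∈supp⇔ u {x} = mk⇔
  (λ x∈ → toWitnessFalse (Equivalence.to (∈-tabulate nonzeroAt) x∈))
  (λ nz → Equivalence.from (∈-tabulate nonzeroAt) (fromWitnessFalse nz))
  where
  nonzeroAt : Fin _ → Bool
  nonzeroAt y = isNonZero (lookup u y)

∈agreeSupp⇔ : {q n : ℕ} (u v : Word q n) {x : Fin n} →
  x ∈ agreeSupp u v ⇔ (lookup u x ≡ lookup v x × NonZeroᶻ (lookup u x))
∈agreeSupp⇔ u v {x} = mk⇔
  (λ x∈ → let (eq , nz) = Equivalence.to T-∧ (Equivalence.to (∈-tabulate agreesAt) x∈)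
          in toWitness {a? = equal?} eq , toWitnessFalse {a? = zero?} nz)
  (λ (eq , nz) → Equivalence.from (∈-tabulate agreesAt)
                   (Equivalence.from (T-∧ {⌊ equal? ⌋} {not ⌊ zero? ⌋})
                     (fromWitness eq , fromWitnessFalse nz)))
  where
  equal? : Dec (lookup u x ≡ lookup v x)
  equal? = lookup u x F.≟ lookup v x
  zero? : Dec (toℕ (lookup u x) ≡ 0)
  zero?  = toℕ (lookup u x) ℕ.≟ 0
  agreesAt : Fin _ → Bool
  agreesAt y = agrees (lookup u y) (lookup v y)

agreeSupp⊆common : {q n : ℕ} (u v : Word q n) → agreeSupp u v ⊆ supp u ∩ supp v
agreeSupp⊆common u v x∈ with Equivalence.to (∈agreeSupp⇔ u v) x∈
... | ux≡vx , nz = x∈p∩q⁺ ( Equivalence.from (∈supp⇔ u) nz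
                          , Equivalence.from (∈supp⇔ v) (subst NonZeroᶻ ux≡vx nz))

bit : Bool → ℕ
bit true  = 1
bit false = 0

∣∷∣ : {n : ℕ} (b : Bool) (s : Subset n) → ∣ b ∷ s ∣ ≡ bit b + ∣ s ∣
∣∷∣ true  s = refl
∣∷∣ false s = refl

coordinate-count : {q : ℕ} (a b : Fin q) →
    bit (not ⌊ a F.≟ b ⌋) + bit (isNonZero a ∧ isNonZero b)
      + bit (agrees a b)
  ≡ bit (isNonZero a) + bit (isNonZero b)
coordinate-count a b with a F.≟ b
coordinate-count a .a | yes refl with toℕ a ℕ.≟ 0
... | yes _ = refl
... | no  _ = refl
coordinate-count a b | no a≢b with toℕ a ℕ.≟ 0 | toℕ b ℕ.≟ 0
... | yes a≡0 | yes b≡0 = ⊥-elim (a≢b (toℕ-injective (trans a≡0 (sym b≡0))))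
... | yes _   | no  _   = refl
... | no  _   | yes _   = refl
... | no  _   | no  _   = refl

distance-identity : {q n : ℕ} (u v : Word q n) →
  dist u v + ∣ supp u ∩ supp v ∣ + ∣ agreeSupp u v ∣ ≡ weight u + weight v
distance-identity []      []      = refl
distance-identity (a ∷ u) (b ∷ v) = begin
    ∣ δ ∷ diffSupp u v ∣ + ∣ κ ∷ (supp u ∩ supp v) ∣ + ∣ α ∷ agreeSupp u v ∣
  ≡⟨ cong₂ _+_ (cong₂ _+_ (∣∷∣ δ (diffSupp u v)) (∣∷∣ κ (supp u ∩ supp v))) (∣∷∣ α (agreeSupp u v)) ⟩
    (bit δ + dist u v) + (bit κ + ∣ supp u ∩ supp v ∣) + (bit α + ∣ agreeSupp u v ∣)
  ≡⟨ regroup (bit δ) (dist u v) (bit κ) _ (bit α) _ ⟩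
    (bit δ + bit κ + bit α) + (dist u v + ∣ supp u ∩ supp v ∣ + ∣ agreeSupp u v ∣)
  ≡⟨ cong₂ _+_ (coordinate-count a b) (distance-identity u v) ⟩
    (bit (isNonZero a) + bit (isNonZero b)) + (weight u + weight v)
  ≡⟨ interchange (bit (isNonZero a)) _ (weight u) _ ⟩
    (bit (isNonZero a) + weight u) + (bit (isNonZero b) + weight v)
  ≡⟨ sym (cong₂ _+_ (∣∷∣ (isNonZero a) (supp u)) (∣∷∣ (isNonZero b) (supp v))) ⟩
    weight (a ∷ u) + weight (b ∷ v)
  ∎
  where
  open ≡-Reasoning
  δ κ α : Bool
  δ = not ⌊ a F.≟ b ⌋
  κ = isNonZero a ∧ isNonZero b
  α = agrees a b
  regroup : ∀ p x r y s z → (p + x) + (r + y) + (s + z) ≡ (p + r + s) + (x + y + z)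
  regroup = solve-∀
  interchange : ∀ p r x y → (p + r) + (x + y) ≡ (p + x) + (r + y)
  interchange = solve-∀

excess : {q n : ℕ} → Word q n → Word q n → ℕ
excess u v = ∣ supp u ∩ supp v ∣ + ∣ agreeSupp u v ∣

distance⇔excess : {q n : ℕ} (w : ℕ) (u v : Word q n) → weight u ≡ w → weight v ≡ w →
  (2 * w ∸ 2 ≤ dist u v) ⇔ (excess u v ≤ 2)
distance⇔excess w u v wt-u wt-v = lower-bound⇔slack 2 (begin
    dist u v + excess u v
  ≡⟨ sym (+-assoc (dist u v) _ _) ⟩
    dist u v + ∣ supp u ∩ supp v ∣ + ∣ agreeSupp u v ∣
  ≡⟨ distance-identity u v ⟩
    weight u + weight v
  ≡⟨ cong₂ _+_ wt-u (trans wt-v (sym (+-identityʳ w))) ⟩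
    2 * w
  ∎)
  where open ≡-Reasoning

SharedPair : {q n : ℕ} → Word q n → Word q n → Set
SharedPair {q} u v = ∃ λ (i : Fin q) → NonZeroᶻ i × ∃₂ λ x y → Arises i u x y × Arises i v x y

SharedPair⇔ : {q n : ℕ} (u v : Word q n) →
  SharedPair u v ⇔ (1 ≤ ∣ agreeSupp u v ∣ × 2 ≤ ∣ supp u ∩ supp v ∣)
SharedPair⇔ u v = mk⇔ to from
  where
  common : ∀ {x} → x ∈ supp u → x ∈ supp v → x ∈ supp u ∩ supp v
  common x∈u x∈v = x∈p∩q⁺ (x∈u , x∈v)
  to : SharedPair u v → 1 ≤ ∣ agreeSupp u v ∣ × 2 ≤ ∣ supp u ∩ supp v ∣
  to (i , nz , x , y , (ux≡i , y∈u , y≢x) , (vx≡i , y∈v , _)) =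
      ∈⇒1≤∣p∣ (Equivalence.from (∈agreeSupp⇔ u v) (trans ux≡i (sym vx≡i) , subst NonZeroᶻ (sym ux≡i) nz))
    , distinct⇒2≤∣p∣ (common (Equivalence.from (∈supp⇔ u) (subst NonZeroᶻ (sym ux≡i) nz))
                             (Equivalence.from (∈supp⇔ v) (subst NonZeroᶻ (sym vx≡i) nz)))
                     (common y∈u y∈v) y≢x
  from : 1 ≤ ∣ agreeSupp u v ∣ × 2 ≤ ∣ supp u ∩ supp v ∣ → SharedPair u v
  from (1≤a , 2≤c) with 1≤∣p∣⇒nonempty 1≤a
  ... | x , x∈A with Equivalence.to (∈agreeSupp⇔ u v) x∈A | another-element {x = x} 2≤c
  ...   | ux≡vx , nz | y , y∈c , y≢x =
    let (y∈u , y∈v) = x∈p∩q⁻ (supp u) (supp v) y∈c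
    in lookup u x , nz , x , y , (refl , y∈u , y≢x) , (sym ux≡vx , y∈v , y≢x)

Pairwise : {q n : ℕ} → Code q n → (Word q n → Word q n → Set) → Set
Pairwise C P = ∀ u v → C u → C v → u ≢ v → P u v

Pairwise-cong : {q n : ℕ} (C : Code q n) {P Q : Word q n → Word q n → Set} →
  (∀ u v → C u → C v → P u v ⇔ Q u v) → Pairwise C P ⇔ Pairwise C Q
Pairwise-cong C P⇔Q = mk⇔
  (λ all-P u v cu cv u≢v → Equivalence.to   (P⇔Q u v cu cv) (all-P u v cu cv u≢v))
  (λ all-Q u v cu cv u≢v → Equivalence.from (P⇔Q u v cu cv) (all-Q u v cu cv u≢v))

Pairwise-× : {q n : ℕ} (C : Code q n) {P Q : Word q n → Word q n → Set} →
  Pairwise C (λ u v → P u v × Q u v) ⇔ (Pairwise C P × Pairwise C Q)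
Pairwise-× C = mk⇔
  (λ all-PQ → (λ u v cu cv u≢v → proj₁ (all-PQ u v cu cv u≢v))
            , (λ u v cu cv u≢v → proj₂ (all-PQ u v cu cv u≢v)))
  (λ (all-P , all-Q) u v cu cv u≢v → all-P u v cu cv u≢v , all-Q u v cu cv u≢v)

-- (C1) says exactly that no two distinct codewords share a pair
-- (words have decidable equality, so "equal whenever sharing" is "distinct ⇒ not sharing").
C1⇔noSharedPair : {q n : ℕ} (C : Code q n) → C1 C ⇔ Pairwise C (λ u v → ¬ SharedPair u v)
C1⇔noSharedPair C = mk⇔
  (λ c1 u v cu cv u≢v (i , nz , x , y , in-u , in-v) → u≢v (c1 i nz u v cu cv x y in-u in-v))
  (λ none i nz u v cu cv x y in-u in-v → decidable-stable (≡-dec F._≟_ u v) (λ u≢v →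
      none u v cu cv u≢v (i , nz , x , y , in-u , in-v)))

excess⇔C1C2 : {q n : ℕ} (u v : Word q n) →
  (excess u v ≤ 2) ⇔ (¬ SharedPair u v × ∣ supp u ∩ supp v ∣ ≤ 2)
excess⇔C1C2 u v = begin
    (excess u v ≤ 2)
  ≈⟨ small-sum (p⊆q⇒∣p∣≤∣q∣ (agreeSupp⊆common u v)) ⟩
    (¬ (1 ≤ ∣ agreeSupp u v ∣ × 2 ≤ ∣ supp u ∩ supp v ∣) × ∣ supp u ∩ supp v ∣ ≤ 2)
  ≈⟨ ¬-cong-⇔ (⇔-sym (SharedPair⇔ u v)) ×-⇔ ⇔-refl ⟩
    (¬ SharedPair u v × ∣ supp u ∩ supp v ∣ ≤ 2)
  ∎
  where open SetoidReasoning (⇔-setoid _)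

lemma3 : (q n w : ℕ) → 2 ≤ q → (C : Code q n) →
    (∀ u → C u → weight u ≡ w) →
    HasDistance C (2 * w ∸ 2) ⇔ (C1 C × C2 C)
lemma3 q n w _ C wt = begin
    HasDistance C (2 * w ∸ 2)
  ≈⟨ Pairwise-cong C (λ u v cu cv → distance⇔excess w u v (wt u cu) (wt v cv)) ⟩
    Pairwise C (λ u v → excess u v ≤ 2)
  ≈⟨ Pairwise-cong C (λ u v _ _ → excess⇔C1C2 u v) ⟩
    Pairwise C (λ u v → ¬ SharedPair u v × ∣ supp u ∩ supp v ∣ ≤ 2)
  ≈⟨ Pairwise-× C ⟩
    (Pairwise C (λ u v → ¬ SharedPair u v) × C2 C)
  ≈⟨ ⇔-sym (C1⇔noSharedPair C) ×-⇔ ⇔-refl ⟩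
    (C1 C × C2 C)
  ∎
  where open SetoidReasoning (⇔-setoid _)
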